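{- Let $c\in\mathbb{Z}^l$, let $m=\max\{c_1,\dots,c_l\}$ and $K=\{k\in\{1,\dots,l\}: c_k=m\}$. For $n\in\mathbb{N}$ define the $l$-multipartition $\lambda$ by $\lambda^{(k)}=(n)$ for $k\in K$ and $\lambda^{(k)}=\varnothing$ for $k\notin K$. Then $\lambda\in\mathcal{C}_{(0|c)}$.
   Context: An $l$-multipartition is an $l$-tuple of partitions, with nodes $(a,b,k)$ for $b\le\lambda^{(k)}_a$; $(n)$ denotes the partition with a single part $n$. The $(0\,|\,c)$-residue of $(a,b,k)$ is the integer $b-a+c_k$; the $(0\,|\,c)$-content is the multiset of residues of the nodes; $\lambda$ is a $(0\,|\,c)$-core if no other $l$-multipartition has the same $(0\,|\,c)$-content. $\mathcal{C}_{(0|c)}$ is the set of $(0\,|\,c)$-cores. -}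

module Defs where

open import Data.Nat using (ℕ; zero; suc; _≤_; _≥_; s≤s; z≤n)
open import Data.Integer using (ℤ; +_; _+_; _-_; _⊔_)
open import Data.Integer.Properties using () renaming (_≟_ to _≟ℤ_)
open import Data.List using (List; []; _∷_; _++_; map; upTo; concat)
open import Data.List.Relation.Unary.All using (All; []; _∷_)
open import Data.List.Relation.Unary.Linked using (Linked; []; [-]; _∷_)
open import Data.List.Relation.Binary.Permutation.Propositional using (_↭_)
open import Data.Vec using (Vec; []; _∷_; foldr₁; zipWith; toList)
import Data.Vec as V
open import Data.Product using (_×_)
open import Relation.Binary.PropositionalEquality using (_≡_)
open import Relation.Nullary using (yes; no)

record Partition : Set where
  constructor mkPartition
  field
    parts      : List ℕ
    positive   : All (1 ≤_) parts
    decreasing : Linked _≥_ parts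
open Partition public

Multipartition : ℕ → Set
Multipartition l = Vec Partition l

_≈ᴹ_ : ∀ {l} → Multipartition l → Multipartition l → Set
μ ≈ᴹ ν = V.map parts μ ≡ V.map parts ν

∅ₚ : Partition
∅ₚ = mkPartition [] [] []

single : ℕ → Partition
single zero    = ∅ₚ
single (suc n) = mkPartition (suc n ∷ []) (s≤s z≤n ∷ []) [-]

-- Residues of the nodes (a, b) with 1 ≤ b ≤ len in row a, for charge ck:  b - a + ck.
rowResidues : ℤ → ℕ → ℕ → List ℤ
rowResidues ck a len = map (λ j → (+ suc j) - (+ a) + ck) (upTo len)

partResidues : ℤ → ℕ → List ℕ → List ℤ
partResidues ck a []         = []
partResidues ck a (r ∷ rows) = rowResidues ck a r ++ partResidues ck (suc a) rows

-- The (0|c)-content of an l-multipartition, as a list of residues (a multiset,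
-- compared up to permutation).
content : ∀ {l} → Vec ℤ l → Multipartition l → List ℤ
content c μ = concat (toList (zipWith (λ ck p → partResidues ck 1 (parts p)) c μ))

SameContent : ∀ {l} → Vec ℤ l → Multipartition l → Multipartition l → Set
SameContent c μ ν = content c μ ↭ content c ν

IsCore : ∀ {l} → Vec ℤ l → Multipartition l → Set
IsCore c λ' = ∀ μ → SameContent c μ λ' → μ ≈ᴹ λ'

maxCharge : ∀ {l} → Vec ℤ (suc l) → ℤ
maxCharge c = foldr₁ _⊔_ c

topMultipartition : ∀ {l} → Vec ℤ (suc l) → ℕ → Multipartition (suc l)
topMultipartition c n = V.map (λ ck → pick ck) c
  where
    pick : ℤ → Partition
    pick ck with ck ≟ℤ maxCharge c
    ... | yes _ = single n
    ... | no  _ = ∅ₚ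

module Submission where

-- Let M = max c. Every node of λ has residue in the window [M, M + n), so the same holds for any μ
-- with the same content. A nonempty component μ⁽ᵏ⁾ then has c_k = M (its corner has residue
-- c_k ≤ M), a single row (a second row would start at residue M − 1) and at most n nodes. Hence
-- each μ⁽ᵏ⁾ is dominated by λ⁽ᵏ⁾, and equal total size forces μ = λ.

open import Defs
open import Data.Nat using (ℕ; suc; zero)
open import Data.Integer using (ℤ)
open import Data.Vec using (Vec)

open import Data.Nat as ℕ using (z≤n; z<s)
import Data.Nat.Properties as ℕ
open import Data.Integer as ℤ using (+_; +≤+; +<+; _≤_; _<_)
import Data.Integer.Properties as ℤ
open import Data.List using (List; []; _∷_; _++_; length; upTo)
open import Data.List.Properties using (map-upTo; length-++; length-map; length-upTo; ++-identityʳ)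
open import Data.List.Relation.Unary.All using (All; []; _∷_)
open import Data.List.Relation.Unary.All.Properties using (++⁺; ++⁻ˡ; ++⁻ʳ; applyUpTo⁺₁; applyUpTo⁻)
open import Data.List.Relation.Binary.Permutation.Propositional using (↭-sym)
open import Data.List.Relation.Binary.Permutation.Propositional.Properties using (All-resp-↭; ↭-length)
open import Data.Vec as Vec using (_∷_; lookup)
open import Data.Vec.Properties using (lookup-map)
import Data.Vec.Relation.Unary.All as VecAll
open import Data.Vec.Relation.Binary.Pointwise.Inductive using (Pointwise; []; _∷_)
open import Data.Vec.Relation.Binary.Pointwise.Extensional using (ext; extensional⇒inductive)
open import Data.Product using (_×_; _,_; proj₁; proj₂; ∃-syntax; uncurry; map₂)
open import Data.Sum using (_⊎_; inj₁; inj₂)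
open import Data.Empty using (⊥-elim)
open import Function using (_∘_)
open import Relation.Nullary using (¬_; yes; no)
open import Relation.Binary.PropositionalEquality

+-≤-tight : ∀ {m m′ n n′} → m ℕ.≤ m′ → n ℕ.≤ n′ → m ℕ.+ n ≡ m′ ℕ.+ n′ → m ≡ m′ × n ≡ n′
+-≤-tight {m} {m′} {n} {n′} m≤m′ n≤n′ eq with ℕ.m≤n⇒m<n∨m≡n m≤m′
... | inj₂ refl = refl , ℕ.+-cancelˡ-≡ m n n′ eq
... | inj₁ m<m′ = ⊥-elim (ℕ.<-irrefl eq (ℕ.+-mono-<-≤ m<m′ n≤n′))

Dominated : ℕ → ℕ → Set → Set
Dominated m m′ P = m ℕ.≤ m′ × (m ≡ m′ → P)

+-dominated : ∀ {m m′ n n′ P Q} → Dominated m m′ P → Dominated n n′ Q →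
              Dominated (m ℕ.+ n) (m′ ℕ.+ n′) (P × Q)
+-dominated (m≤m′ , P-if-≡) (n≤n′ , Q-if-≡) =
  ℕ.+-mono-≤ m≤m′ n≤n′ ,
  λ eq → let m≡m′ , n≡n′ = +-≤-tight m≤m′ n≤n′ eq in P-if-≡ m≡m′ , Q-if-≡ n≡n′

≤-maxCharge : ∀ {l} (c : Vec ℤ (suc l)) → VecAll.All (_≤ maxCharge c) c
≤-maxCharge (x ∷ Vec.[]) = ℤ.≤-refl VecAll.∷ VecAll.[]
≤-maxCharge (x ∷ y ∷ ys) =
  ℤ.i≤i⊔j x _ VecAll.∷ VecAll.map (λ z≤m → ℤ.≤-trans z≤m (ℤ.i≤j⊔i x _)) (≤-maxCharge (y ∷ ys))

residues : ℤ → Partition → List ℤ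
residues ck p = partResidues ck 1 (parts p)

rowResidues-All⁺ : ∀ {P : ℤ → Set} ck len → (∀ {j} → j ℕ.< len → P (+ j ℤ.+ ck)) →
                   All P (rowResidues ck 1 len)
rowResidues-All⁺ {P} ck len h = subst (All P) (sym (map-upTo _ len)) (applyUpTo⁺₁ _ len h)

rowResidues-All⁻ : ∀ {P : ℤ → Set} ck len → All P (rowResidues ck 1 len) →
                   ∀ {j} → j ℕ.< len → P (+ j ℤ.+ ck)
rowResidues-All⁻ {P} ck len h = applyUpTo⁻ _ len (subst (All P) (map-upTo _ len) h)

length-residues-single : ∀ ck p k → parts p ≡ parts (single k) → length (residues ck p) ≡ k
length-residues-single ck _ zero    p≡k rewrite p≡k = refl
length-residues-single ck _ (suc k) p≡k rewrite p≡k = begin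
  length (rowResidues ck 1 (suc k) ++ []) ≡⟨ cong length (++-identityʳ (rowResidues ck 1 (suc k))) ⟩
  length (rowResidues ck 1 (suc k))       ≡⟨ length-map _ (upTo (suc k)) ⟩
  length (upTo (suc k))                   ≡⟨ length-upTo (suc k) ⟩
  suc k                                   ∎
  where open ≡-Reasoning

module _ (M : ℤ) (n : ℕ) where

  InWindow : ℤ → Set
  InWindow x = M ≤ x × x < + n ℤ.+ M

  inWindow⁺ : ∀ {j} → j ℕ.< n → InWindow (+ j ℤ.+ M)
  inWindow⁺ {j} j<n = ℤ.i≤j+i M (+ j) , ℤ.+-monoˡ-< M (+<+ j<n)

  inWindow⁻ : ∀ {j} → InWindow (+ j ℤ.+ M) → j ℕ.< n
  inWindow⁻ (_ , j+M<n+M) = ℕ.≰⇒> λ n≤j → ℤ.<⇒≱ j+M<n+M (ℤ.+-monoˡ-≤ M (+≤+ n≤j))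

  data IsTopComponent (ck : ℤ) (q : Partition) : Set where
    top   : ck ≡ M → parts q ≡ parts (single n) → IsTopComponent ck q
    empty : ¬ ck ≡ M → parts q ≡ [] → IsTopComponent ck q

  residues-single-inWindow : ∀ k → k ℕ.≤ n → All InWindow (partResidues M 1 (parts (single k)))
  residues-single-inWindow zero    _   = []
  residues-single-inWindow (suc k) k≤n =
    ++⁺ (rowResidues-All⁺ M (suc k) (λ j<k → inWindow⁺ (ℕ.<-≤-trans j<k k≤n))) []

  topComponent-inWindow : ∀ {ck q} → IsTopComponent ck q → All InWindow (residues ck q)
  topComponent-inWindow (top refl q≡n) =
    subst (All InWindow ∘ partResidues M 1) (sym q≡n) (residues-single-inWindow n ℕ.≤-refl)
  topComponent-inWindow (empty _ q≡∅) =
    subst (All InWindow ∘ partResidues _ 1) (sym q≡∅) []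

  -- The first node of a second row has residue M - 1, just below the window.
  lowerRows-empty : ∀ {rows} → All (1 ℕ.≤_) rows → All InWindow (partResidues M 2 rows) → rows ≡ []
  lowerRows-empty {[]}        _ _ = refl
  lowerRows-empty {zero ∷ _}  (() ∷ _) _
  lowerRows-empty {suc _ ∷ _} _ ((M≤pred[M] , _) ∷ _) =
    ⊥-elim (ℤ.≤⇒≯ M≤pred[M] (ℤ.i≤pred[j]⇒i<j ℤ.≤-refl))

  firstRow-charge : ∀ {ck len} → ck ≤ M → All InWindow (rowResidues ck 1 (suc len)) → ck ≡ M
  firstRow-charge {ck} {len} ck≤M row =
    ℤ.≤-antisym ck≤M (subst (M ≤_) (ℤ.+-identityˡ ck) (proj₁ (rowResidues-All⁻ ck (suc len) row z<s)))

  inWindow-shape : ∀ {ck} p → ck ≤ M → All InWindow (residues ck p) →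
                   ∃[ k ] (parts p ≡ parts (single k) × (k ≡ 0 ⊎ ck ≡ M × k ℕ.≤ n))
  inWindow-shape (mkPartition []             _              _) _ _ = 0 , refl , inj₁ refl
  inWindow-shape {ck} (mkPartition (suc r ∷ rest) (_ ∷ positive) _) ck≤M window
    with refl ← firstRow-charge ck≤M (++⁻ˡ (rowResidues ck 1 (suc r)) window) =
    suc r , cong (suc r ∷_) (lowerRows-empty positive (++⁻ʳ (rowResidues M 1 (suc r)) window)) ,
    inj₂ (refl , inWindow⁻ (rowResidues-All⁻ M (suc r) (++⁻ˡ (rowResidues M 1 (suc r)) window) ℕ.≤-refl))

  component-dominated : ∀ {ck q} p → ck ≤ M → IsTopComponent ck q → All InWindow (residues ck p) →
                        Dominated (length (residues ck p)) (length (residues ck q)) (parts p ≡ parts q)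
  component-dominated {ck} {q} p ck≤M isTop window with inWindow-shape p ck≤M window
  ... | k , p≡k , k≡0∨k≤n = dominated isTop k≡0∨k≤n
    where
    dominated-by : ∀ m → k ℕ.≤ m → parts q ≡ parts (single m) →
                   Dominated (length (residues ck p)) (length (residues ck q)) (parts p ≡ parts q)
    dominated-by m k≤m q≡m = subst₂ ℕ._≤_ (sym size-p) (sym size-q) k≤m , λ p≈q →
      trans p≡k (trans (cong (parts ∘ single) (trans (sym size-p) (trans p≈q size-q))) (sym q≡m))
      where
      size-p : length (residues ck p) ≡ k
      size-p = length-residues-single ck p k p≡k
      size-q : length (residues ck q) ≡ m
      size-q = length-residues-single ck q m q≡m

    dominated : IsTopComponent ck q → k ≡ 0 ⊎ ck ≡ M × k ℕ.≤ n →
                Dominated (length (residues ck p)) (length (residues ck q)) (parts p ≡ parts q)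
    dominated (top _ q≡n)    (inj₁ refl)        = dominated-by n z≤n q≡n
    dominated (top _ q≡n)    (inj₂ (_ , k≤n))   = dominated-by n k≤n q≡n
    dominated (empty _ q≡∅)  (inj₁ refl)        = dominated-by 0 z≤n q≡∅
    dominated (empty ck≢M _) (inj₂ (ck≡M , _)) = ⊥-elim (ck≢M ck≡M)

  content-inWindow : ∀ {L} {cs : Vec ℤ L} {ν} → Pointwise IsTopComponent cs ν → All InWindow (content cs ν)
  content-inWindow []               = []
  content-inWindow (isTop ∷ isTops) = ++⁺ (topComponent-inWindow isTop) (content-inWindow isTops)

  content-dominated : ∀ {L} {cs : Vec ℤ L} {ν} μ → VecAll.All (_≤ M) cs → Pointwise IsTopComponent cs ν →
                      All InWindow (content cs μ) →
                      Dominated (length (content cs μ)) (length (content cs ν)) (μ ≈ᴹ ν)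
  content-dominated Vec.[] VecAll.[] [] [] = z≤n , λ _ → refl
  content-dominated {cs = ck ∷ cs} {q ∷ ν} (p ∷ μ) (ck≤M VecAll.∷ cs≤M) (isTop ∷ isTops) window =
    subst₂ (λ a b → Dominated a b ((p ∷ μ) ≈ᴹ (q ∷ ν)))
      (sym (length-++ (residues ck p))) (sym (length-++ (residues ck q)))
      (map₂ (uncurry (cong₂ _∷_) ∘_) (+-dominated
        (component-dominated p ck≤M isTop (++⁻ˡ (residues ck p) window))
        (content-dominated μ cs≤M isTops (++⁻ʳ (residues ck p) window))))

-- The right-hand side is the anonymous local function of topMultipartition; it cannot be
-- named here, so unification supplies it.
lookup-topMultipartition : ∀ {l} (c : Vec ℤ (suc l)) n i → lookup (topMultipartition c n) i ≡ _
lookup-topMultipartition c n i = lookup-map i _ c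

topMultipartition-isTop : ∀ {l} (c : Vec ℤ (suc l)) n →
                          Pointwise (IsTopComponent (maxCharge c) n) c (topMultipartition c n)
topMultipartition-isTop c n = extensional⇒inductive (ext component)
  where
  component : ∀ i → IsTopComponent (maxCharge c) n (lookup c i) (lookup (topMultipartition c n) i)
  component i rewrite lookup-topMultipartition c n i with lookup c i ℤ.≟ maxCharge c
  ... | yes ck≡M = top ck≡M refl
  ... | no  ck≢M = empty ck≢M refl

lemma3p3 : (l : ℕ) (c : Vec ℤ (suc l)) (n : ℕ) → IsCore c (topMultipartition c n)
lemma3p3 l c n μ sameContent =
  proj₂ (content-dominated M n μ (≤-maxCharge c) tops μ-inWindow) (↭-length sameContent)
  where
  M : ℤ
  M = maxCharge c
  tops : Pointwise (IsTopComponent M n) c (topMultipartition c n)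
  tops = topMultipartition-isTop c n
  μ-inWindow : All (InWindow M n) (content c μ)
  μ-inWindow = All-resp-↭ (↭-sym sameContent) (content-inWindow M n tops)
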